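{- Let $\mathbb F$ be a field, let $\varphi$ be an $\mathbb F^\times$-gain function on $K_4$ such that no triangle is balanced with respect to $\varphi$, and let $\psi$ be any $\mathbb F^\times$-gain function on $K_4$. Then $\varphi$ and $\psi$ are switching equivalent if and only if $A_F(K_4,\varphi)$ and $A_F(K_4,\psi)$ are projectively equivalent.
   Context: An $\mathbb F^\times$-gain function assigns nonzero scalars to oriented edges with $\varphi(e^{ -1})=\varphi(e)^{ -1}$; a cycle is balanced if the product of gains around it is $1$. Switching: $\varphi^\eta(e)=\eta(\mathrm{tail}\,e)^{ -1}\varphi(e)\eta(\mathrm{head}\,e)$; switching equivalent means $\psi=\varphi^\eta$ for some $\eta:V\to\mathbb F^\times$. Frame matrix $A_F(G,\varphi)$: rows $V(G)$, columns $E(G)$, column of link $e$ (fixed orientation) $\hat{\mathrm{tail}(e)}-\varphi(e)\hat{\mathrm{head}(e)}$. Projectively equivalent: related by elementary row operations, nonzero column scalings, and deleting/adjoining zero rows. -}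

module Defs where

open import Level using (Level; _⊔_)
open import Algebra.Bundles using (CommutativeRing)
open import Data.Nat using (ℕ)
open import Data.Fin using (Fin; zero; suc; _≟_)
open import Data.Product using (Σ; _,_; _×_)
open import Relation.Nullary using (¬_; yes; no; Dec)
open import Relation.Binary.PropositionalEquality using (_≡_; _≢_; refl)
open import Relation.Binary.Construct.Closure.Equivalence using (EqClosure)

record Field (c ℓ : Level) : Set (Level.suc (c ⊔ ℓ)) where
  field
    commutativeRing : CommutativeRing c ℓ
  open CommutativeRing commutativeRing public
  field
    _⁻¹        : Carrier → Carrier
    ⁻¹-inverse : ∀ x → ¬ (x ≈ 0#) → x * (x ⁻¹) ≈ 1#
    0≉1        : ¬ (0# ≈ 1#)

data Edge : Set where
  e01 e02 e03 e12 e13 e23 : Edge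

tail : Edge → Fin 4
tail e01 = zero
tail e02 = zero
tail e03 = zero
tail e12 = suc zero
tail e13 = suc zero
tail e23 = suc (suc zero)

head : Edge → Fin 4
head e01 = suc zero
head e02 = suc (suc zero)
head e03 = suc (suc (suc zero))
head e12 = suc (suc zero)
head e13 = suc (suc (suc zero))
head e23 = suc (suc (suc zero))

edgeEq? : (e f : Edge) → Dec (e ≡ f)
edgeEq? e01 e01 = yes refl
edgeEq? e02 e02 = yes refl
edgeEq? e03 e03 = yes refl
edgeEq? e12 e12 = yes refl
edgeEq? e13 e13 = yes refl
edgeEq? e23 e23 = yes refl
edgeEq? e01 e02 = no λ ()
edgeEq? e01 e03 = no λ ()
edgeEq? e01 e12 = no λ ()
edgeEq? e01 e13 = no λ ()
edgeEq? e01 e23 = no λ ()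
edgeEq? e02 e01 = no λ ()
edgeEq? e02 e03 = no λ ()
edgeEq? e02 e12 = no λ ()
edgeEq? e02 e13 = no λ ()
edgeEq? e02 e23 = no λ ()
edgeEq? e03 e01 = no λ ()
edgeEq? e03 e02 = no λ ()
edgeEq? e03 e12 = no λ ()
edgeEq? e03 e13 = no λ ()
edgeEq? e03 e23 = no λ ()
edgeEq? e12 e01 = no λ ()
edgeEq? e12 e02 = no λ ()
edgeEq? e12 e03 = no λ ()
edgeEq? e12 e13 = no λ ()
edgeEq? e12 e23 = no λ ()
edgeEq? e13 e01 = no λ ()
edgeEq? e13 e02 = no λ ()
edgeEq? e13 e03 = no λ ()
edgeEq? e13 e12 = no λ ()
edgeEq? e13 e23 = no λ ()
edgeEq? e23 e01 = no λ ()
edgeEq? e23 e02 = no λ ()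
edgeEq? e23 e03 = no λ ()
edgeEq? e23 e12 = no λ ()
edgeEq? e23 e13 = no λ ()

module _ {c ℓ : Level} (𝔽 : Field c ℓ) where
  open Field 𝔽

  -- An 𝔽ˣ-gain function on K₄.  It is determined by its (nonzero) values
  -- on the edges in their fixed orientation; the value on the reversed
  -- edge e⁻¹ is by definition gain e ⁻¹.
  record GainFunction : Set (c ⊔ ℓ) where
    constructor mkGain
    field
      gain    : Edge → Carrier
      nonzero : ∀ e → ¬ (gain e ≈ 0#)
  open GainFunction public

  -- Going around the cycle a → b → c → a traverses ab, bc forwards and
  -- ac backwards, so the gain of the cycle is φ(ab) φ(bc) φ(ac)⁻¹.
  data Triangle : Set where
    t012 t013 t023 t123 : Triangle

  tri-ab tri-bc tri-ac : Triangle → Edge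
  tri-ab t012 = e01
  tri-ab t013 = e01
  tri-ab t023 = e02
  tri-ab t123 = e12
  tri-bc t012 = e12
  tri-bc t013 = e13
  tri-bc t023 = e23
  tri-bc t123 = e23
  tri-ac t012 = e02
  tri-ac t013 = e03
  tri-ac t023 = e03
  tri-ac t123 = e13

  Balanced : GainFunction → Triangle → Set ℓ
  Balanced φ t = (gain φ (tri-ab t) * gain φ (tri-bc t)) * (gain φ (tri-ac t) ⁻¹) ≈ 1#

  -- Switching equivalence: ψ = φ^η for some η : V → 𝔽ˣ, where
  -- φ^η(e) = η(tail e)⁻¹ φ(e) η(head e).  (Checking this on the fixed
  -- orientation of each edge suffices, the reversed edges then agree.)
  SwitchingEquivalent : GainFunction → GainFunction → Set (c ⊔ ℓ)
  SwitchingEquivalent φ ψ =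
    Σ (Fin 4 → Carrier) λ η →
      (∀ v → ¬ (η v ≈ 0#)) × (∀ e → gain ψ e ≈ ((η (tail e) ⁻¹) * gain φ e) * η (head e))

  Mat : ℕ → Set c
  Mat m = Fin m → Edge → Carrier

  frameMatrix : GainFunction → Mat 4
  frameMatrix φ v e with v ≟ tail e
  ... | yes _ = 1#
  ... | no _ with v ≟ head e
  ...   | yes _ = - gain φ e
  ...   | no _ = 0#

  AnyMat : Set c
  AnyMat = Σ ℕ Mat

  private
    pick : ∀ {m} → Fin m → Fin m → Carrier → Carrier → Carrier
    pick k i x y with k ≟ i
    ... | yes _ = x
    ... | no _ = y

    swapIdx : ∀ {m} → Fin m → Fin m → Fin m → Fin m
    swapIdx i j k with k ≟ i
    ... | yes _ = j
    ... | no _ with k ≟ j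
    ...   | yes _ = i
    ...   | no _ = k

    colPick : Edge → Edge → Carrier → Carrier → Carrier
    colPick e f x y with edgeEq? e f
    ... | yes _ = x
    ... | no _ = y


  -- Deleting a zero row is the
  -- inverse of adjoining one and is covered by taking the equivalence
  -- closure below.
  data Step : AnyMat → AnyMat → Set (c ⊔ ℓ) where
    ≈-step     : ∀ {m} (A B : Mat m) → (∀ i e → A i e ≈ B i e) → Step (m , A) (m , B)
    rowSwap    : ∀ {m} (A : Mat m) (i j : Fin m) →
                 Step (m , A) (m , λ k e → A (swapIdx i j k) e)
    rowScale   : ∀ {m} (A : Mat m) (i : Fin m) (a : Carrier) → ¬ (a ≈ 0#) →
                 Step (m , A) (m , λ k e → pick k i (a * A k e) (A k e))
    rowAdd     : ∀ {m} (A : Mat m) (i j : Fin m) (a : Carrier) → i ≢ j →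
                 Step (m , A) (m , λ k e → pick k i (A i e + a * A j e) (A k e))
    colScale   : ∀ {m} (A : Mat m) (f : Edge) (a : Carrier) → ¬ (a ≈ 0#) →
                 Step (m , A) (m , λ k e → colPick e f (A k e * a) (A k e))
    adjoinZero : ∀ {m} (A : Mat m) →
                 Step (m , A) (Data.Nat.suc m , λ { zero e → 0# ; (suc k) e → A k e })

  ProjectivelyEquivalent : AnyMat → AnyMat → Set (c ⊔ ℓ)
  ProjectivelyEquivalent = EqClosure Step

-- Switching by η amounts to scaling row v of the frame matrix by η v and column e by
-- η (tail e)⁻¹, which gives one direction.  Conversely, row operations and column scalings
-- preserve the kernel of a matrix up to a nonzero rescaling d of the columns.  For every
-- edge r, the frame matrix of the theta graph K₄ − r has a kernel vector whose entries on
-- the two other edges at an endpoint v of r are, up to frame entries, the imbalance of the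
-- triangle opposite v, hence nonzero when no triangle is balanced.  Carrying these vectors
-- over to the kernel of A_F(K₄, ψ) shows that at each vertex v the ratio
-- d e · A_F(ψ)(v, e) / A_F(φ)(v, e) is the same for the three edges e at v; this common
-- value η v switches φ to ψ.

module Submission where

open import Level using (Level; _⊔_)
open import Algebra.Bundles using (CommutativeRing)
open import Algebra.Solver.Ring.AlmostCommutativeRing using (_-Raw-AlmostCommutative⟶_; fromCommutativeRing)
open import Data.Nat as ℕ using (ℕ; zero; suc)
import Data.Nat.Properties as ℕ
open import Data.Integer as ℤ using (ℤ; +_; -[1+_]; sign; ∣_∣; _◃_; _⊖_)
import Data.Integer.Properties as ℤ
open import Data.Sign as Sign using (Sign)
open import Data.Maybe using (Maybe; just; nothing)
open import Data.Fin using (Fin; zero; suc; _≟_; _↑ˡ_; _↑ʳ_; #_)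
open import Data.Vec using (Vec; []; _∷_; _++_; lookup)
open import Data.Vec.Properties using (lookup-++ˡ; lookup-++ʳ)
open import Data.Product using (Σ-syntax; _,_; _×_; proj₁; proj₂)
open import Data.Empty using (⊥-elim)
open import Function.Bundles using (_⇔_; mk⇔)
open import Relation.Nullary using (¬_; yes; no)
open import Relation.Binary.PropositionalEquality as ≡ using (_≡_; _≢_; subst)
open import Relation.Binary.Construct.Closure.ReflexiveTransitive as Star using (ε; _◅_; _◅◅_)
open import Relation.Binary.Construct.Closure.Symmetric using (SymClosure; fwd; bwd)
open import Defs

-- Equality in an abstract commutative ring is undecidable, so the ring solver takes its
-- coefficients from ℤ, mapped into the ring by n ↦ n × 1#.
module IntegerCoefficients {c ℓ : Level} (R : CommutativeRing c ℓ) where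
  open CommutativeRing R hiding (zero)
  open import Algebra.Properties.Ring ring using (-1*x≈-x; -‿distribˡ-*; -‿distribʳ-*; -‿involutive; -0#≈0#)
  open import Algebra.Properties.AbelianGroup +-abelianGroup using (⁻¹-∙-comm)
  open import Algebra.Properties.Semiring.Mult.TCOptimised semiring using (1+×; ×-homo-+; ×1-homo-*) renaming (_×_ to _×′_)
  open import Relation.Binary.Reasoning.Setoid setoid

  ⟦_⟧ℕ : ℕ → Carrier
  ⟦ n ⟧ℕ = n ×′ 1#

  ⟦_⟧ℤ : ℤ → Carrier
  ⟦ + n ⟧ℤ = ⟦ n ⟧ℕ
  ⟦ -[1+ n ] ⟧ℤ = - ⟦ suc n ⟧ℕ

  ⟦_⟧± : Sign → Carrier
  ⟦ Sign.+ ⟧± = 1#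
  ⟦ Sign.- ⟧± = - 1#

  ⟦◃⟧ : ∀ s n → ⟦ s ◃ n ⟧ℤ ≈ ⟦ s ⟧± * ⟦ n ⟧ℕ
  ⟦◃⟧ s zero = sym (zeroʳ _)
  ⟦◃⟧ Sign.+ (suc n) = sym (*-identityˡ _)
  ⟦◃⟧ Sign.- (suc n) = sym (-1*x≈-x _)

  ⟦⟧ℤ-signAbs : ∀ i → ⟦ i ⟧ℤ ≈ ⟦ sign i ⟧± * ⟦ ∣ i ∣ ⟧ℕ
  ⟦⟧ℤ-signAbs (+ n) = sym (*-identityˡ _)
  ⟦⟧ℤ-signAbs -[1+ n ] = sym (-1*x≈-x _)

  ⟦⟧±-homo-* : ∀ s t → ⟦ s Sign.* t ⟧± ≈ ⟦ s ⟧± * ⟦ t ⟧±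
  ⟦⟧±-homo-* Sign.+ t = sym (*-identityˡ _)
  ⟦⟧±-homo-* Sign.- Sign.+ = sym (*-identityʳ _)
  ⟦⟧±-homo-* Sign.- Sign.- = begin
    1#                ≈⟨ -‿involutive 1# ⟨
    - - 1#            ≈⟨ -‿cong (-1*x≈-x 1#) ⟨
    - (- 1# * 1#)     ≈⟨ -‿distribʳ-* (- 1#) 1# ⟩
    - 1# * - 1#       ∎

  *-homo : ∀ i j → ⟦ i ℤ.* j ⟧ℤ ≈ ⟦ i ⟧ℤ * ⟦ j ⟧ℤ
  *-homo i j = begin
    ⟦ (sign i Sign.* sign j) ◃ (∣ i ∣ ℕ.* ∣ j ∣) ⟧ℤ
      ≈⟨ ⟦◃⟧ (sign i Sign.* sign j) (∣ i ∣ ℕ.* ∣ j ∣) ⟩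
    ⟦ sign i Sign.* sign j ⟧± * ⟦ ∣ i ∣ ℕ.* ∣ j ∣ ⟧ℕ
      ≈⟨ *-cong (⟦⟧±-homo-* (sign i) (sign j)) (×1-homo-* ∣ i ∣ ∣ j ∣) ⟩
    (⟦ sign i ⟧± * ⟦ sign j ⟧±) * (⟦ ∣ i ∣ ⟧ℕ * ⟦ ∣ j ∣ ⟧ℕ)
      ≈⟨ interchange _ _ _ _ ⟩
    (⟦ sign i ⟧± * ⟦ ∣ i ∣ ⟧ℕ) * (⟦ sign j ⟧± * ⟦ ∣ j ∣ ⟧ℕ)
      ≈⟨ *-cong (⟦⟧ℤ-signAbs i) (⟦⟧ℤ-signAbs j) ⟨
    ⟦ i ⟧ℤ * ⟦ j ⟧ℤ ∎
    where open import Algebra.Properties.CommutativeSemigroup *-commutativeSemigroup using (interchange)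

  ⟦⊖⟧ : ∀ m n → ⟦ m ⊖ n ⟧ℤ ≈ ⟦ m ⟧ℕ - ⟦ n ⟧ℕ
  ⟦⊖⟧ m zero = begin
    ⟦ m ⊖ zero ⟧ℤ  ≡⟨ ≡.cong ⟦_⟧ℤ (ℤ.⊖-≥ {m} ℕ.z≤n) ⟩
    ⟦ m ⟧ℕ          ≈⟨ +-identityʳ _ ⟨
    ⟦ m ⟧ℕ + 0#     ≈⟨ +-congˡ -0#≈0# ⟨
    ⟦ m ⟧ℕ - 0#     ∎
  ⟦⊖⟧ zero (suc n) = sym (+-identityˡ _)
  ⟦⊖⟧ (suc m) (suc n) = begin
    ⟦ suc m ⊖ suc n ⟧ℤ                  ≡⟨ ≡.cong ⟦_⟧ℤ (ℤ.[1+m]⊖[1+n]≡m⊖n m n) ⟩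
    ⟦ m ⊖ n ⟧ℤ                          ≈⟨ ⟦⊖⟧ m n ⟩
    ⟦ m ⟧ℕ - ⟦ n ⟧ℕ                     ≈⟨ +-identityˡ _ ⟨
    0# + (⟦ m ⟧ℕ - ⟦ n ⟧ℕ)              ≈⟨ +-congʳ (-‿inverseʳ 1#) ⟨
    (1# - 1#) + (⟦ m ⟧ℕ - ⟦ n ⟧ℕ)       ≈⟨ interchange _ _ _ _ ⟩
    (1# + ⟦ m ⟧ℕ) + (- 1# - ⟦ n ⟧ℕ)     ≈⟨ +-cong (1+× m 1#) (trans (-‿cong (1+× n 1#)) (sym (⁻¹-∙-comm _ _))) ⟨
    ⟦ suc m ⟧ℕ - ⟦ suc n ⟧ℕ             ∎
    where open import Algebra.Properties.CommutativeSemigroup +-commutativeSemigroup using (interchange)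

  +-homo : ∀ i j → ⟦ i ℤ.+ j ⟧ℤ ≈ ⟦ i ⟧ℤ + ⟦ j ⟧ℤ
  +-homo (+ m) (+ n) = ×-homo-+ 1# m n
  +-homo (+ m) -[1+ n ] = ⟦⊖⟧ m (suc n)
  +-homo -[1+ m ] (+ n) = trans (⟦⊖⟧ n (suc m)) (+-comm _ _)
  +-homo -[1+ m ] -[1+ n ] = begin
    - ⟦ suc (suc (m ℕ.+ n)) ⟧ℕ       ≡⟨ ≡.cong (λ k → - ⟦ suc k ⟧ℕ) (ℕ.+-suc m n) ⟨
    - ⟦ suc m ℕ.+ suc n ⟧ℕ           ≈⟨ -‿cong (×-homo-+ 1# (suc m) (suc n)) ⟩
    - (⟦ suc m ⟧ℕ + ⟦ suc n ⟧ℕ)      ≈⟨ ⁻¹-∙-comm _ _ ⟨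
    - ⟦ suc m ⟧ℕ - ⟦ suc n ⟧ℕ        ∎

  -‿homo : ∀ i → ⟦ ℤ.- i ⟧ℤ ≈ - ⟦ i ⟧ℤ
  -‿homo (+ zero) = sym -0#≈0#
  -‿homo (+ suc n) = refl
  -‿homo -[1+ n ] = sym (-‿involutive _)

  ℤ⟶R : ℤ.+-*-rawRing -Raw-AlmostCommutative⟶ fromCommutativeRing R
  ℤ⟶R = record
    { ⟦_⟧ = ⟦_⟧ℤ ; +-homo = +-homo ; *-homo = *-homo ; -‿homo = -‿homo
    ; 0-homo = refl ; 1-homo = refl }

  weakly-decide : ∀ i j → Maybe (⟦ i ⟧ℤ ≈ ⟦ j ⟧ℤ)
  weakly-decide i j with i ℤ.≟ j
  ... | yes ≡.refl = just refl
  ... | no _ = nothing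

  open import Algebra.Solver.Ring ℤ.+-*-rawRing (fromCommutativeRing R) ℤ⟶R weakly-decide public

foldEdges : ∀ {a} {A : Set a} → (A → A → A) → (Edge → A) → A
foldEdges _∙_ f = ((((f e01 ∙ f e02) ∙ f e03) ∙ f e12) ∙ f e13) ∙ f e23

index : Edge → Fin 6
index e01 = # 0
index e02 = # 1
index e03 = # 2
index e12 = # 3
index e13 = # 4
index e23 = # 5

module _ {c ℓ : Level} (𝔽 : Field c ℓ) where
  open Field 𝔽 hiding (zero)
  open IntegerCoefficients commutativeRing
  open import Algebra.Properties.Group +-group using (x∙y⁻¹≈ε⇒x≈y)
  open import Relation.Binary.Reasoning.Setoid setoid

  _≉0 : Carrier → Set ℓ
  x ≉0 = ¬ (x ≈ 0#)

  1≉0 : 1# ≉0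
  1≉0 1≈0 = 0≉1 (sym 1≈0)

  x*y≈0⇒x≈0 : ∀ {x y} → y ≉0 → x * y ≈ 0# → x ≈ 0#
  x*y≈0⇒x≈0 {x} {y} y≉0 xy≈0 = begin
    x                ≈⟨ *-identityʳ x ⟨
    x * 1#           ≈⟨ *-congˡ (⁻¹-inverse y y≉0) ⟨
    x * (y * y ⁻¹)   ≈⟨ *-assoc x y (y ⁻¹) ⟨
    (x * y) * y ⁻¹   ≈⟨ *-congʳ xy≈0 ⟩
    0# * y ⁻¹        ≈⟨ zeroˡ _ ⟩
    0#               ∎

  *-≉0 : ∀ {x y} → x ≉0 → y ≉0 → (x * y) ≉0
  *-≉0 {x} {y} x≉0 y≉0 xy≈0 = x≉0 (x*y≈0⇒x≈0 y≉0 xy≈0)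

  ⁻¹-≉0 : ∀ {x} → x ≉0 → (x ⁻¹) ≉0
  ⁻¹-≉0 {x} x≉0 x⁻¹≈0 = 0≉1 (begin
    0#        ≈⟨ zeroʳ x ⟨
    x * 0#    ≈⟨ *-congˡ x⁻¹≈0 ⟨
    x * x ⁻¹  ≈⟨ ⁻¹-inverse x x≉0 ⟩
    1#        ∎)

  x*a*[a⁻¹*y]≈x*y : ∀ x y {a} → a ≉0 → (x * a) * (a ⁻¹ * y) ≈ x * y
  x*a*[a⁻¹*y]≈x*y x y {a} a≉0 = begin
    (x * a) * (a ⁻¹ * y)  ≈⟨ solve 4 (λ x a b y → (x :* a) :* (b :* y) := (x :* y) :* (a :* b)) refl x a (a ⁻¹) y ⟩
    (x * y) * (a * a ⁻¹)  ≈⟨ *-congˡ (⁻¹-inverse a a≉0) ⟩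
    (x * y) * 1#          ≈⟨ *-identityʳ _ ⟩
    x * y                 ∎

  τ*[x-y]≈0⇒x≈y : ∀ {τ x y} → τ ≉0 → τ * (x - y) ≈ 0# → x ≈ y
  τ*[x-y]≈0⇒x≈y {τ} {x} {y} τ≉0 τ[x-y]≈0 =
    x∙y⁻¹≈ε⇒x≈y x y (x*y≈0⇒x≈0 τ≉0 (trans (*-comm (x - y) τ) τ[x-y]≈0))

  x*a≈y*b⇒x≈y*a⁻¹*b : ∀ {x y a b} → a ≉0 → x * a ≈ y * b → x ≈ (y * a ⁻¹) * b
  x*a≈y*b⇒x≈y*a⁻¹*b {x} {y} {a} {b} a≉0 xa≈yb = begin
    x                  ≈⟨ *-identityʳ x ⟨
    x * 1#             ≈⟨ *-congˡ (⁻¹-inverse a a≉0) ⟨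
    x * (a * a ⁻¹)     ≈⟨ *-assoc x a (a ⁻¹) ⟨
    (x * a) * a ⁻¹     ≈⟨ *-congʳ xa≈yb ⟩
    (y * b) * a ⁻¹     ≈⟨ solve 3 (λ y b a′ → (y :* b) :* a′ := (y :* a′) :* b) refl y b (a ⁻¹) ⟩
    (y * a ⁻¹) * b     ∎

  rescaling⇒switching : ∀ {s t u g q} → t ≉0 → s ≈ t → s * q ≈ u * g → q ≈ (t ⁻¹ * g) * u
  rescaling⇒switching {s} {t} {u} {g} {q} t≉0 s≈t sq≈ug = begin
    q                   ≈⟨ *-identityˡ q ⟨
    1# * q              ≈⟨ *-congʳ (trans (*-comm _ _) (⁻¹-inverse t t≉0)) ⟨
    (t ⁻¹ * t) * q      ≈⟨ *-assoc (t ⁻¹) t q ⟩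
    t ⁻¹ * (t * q)      ≈⟨ *-congˡ (*-congʳ s≈t) ⟨
    t ⁻¹ * (s * q)      ≈⟨ *-congˡ sq≈ug ⟩
    t ⁻¹ * (u * g)      ≈⟨ solve 3 (λ t′ u g → t′ :* (u :* g) := (t′ :* g) :* u) refl (t ⁻¹) u g ⟩
    (t ⁻¹ * g) * u      ∎

  ∑ : (Edge → Carrier) → Carrier
  ∑ = foldEdges _+_

  _·_ : (Edge → Carrier) → (Edge → Carrier) → Carrier
  u · c = ∑ (λ e → u e * c e)

  _⊙_ : (Edge → Carrier) → (Edge → Carrier) → Edge → Carrier
  (d ⊙ c) e = d e * c e

  Kernel : ∀ {m} → Mat 𝔽 m → (Edge → Carrier) → Set ℓ
  Kernel A c = ∀ i → A i · c ≈ 0#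

  ∑-cong : ∀ {f g} → (∀ e → f e ≈ g e) → ∑ f ≈ ∑ g
  ∑-cong f≈g = +-cong (+-cong (+-cong (+-cong (+-cong (f≈g e01) (f≈g e02)) (f≈g e03)) (f≈g e12)) (f≈g e13)) (f≈g e23)

  ·-congˡ : ∀ {u v} c → (∀ e → u e ≈ v e) → u · c ≈ v · c
  ·-congˡ {u} {v} c u≈v = ∑-cong {λ e → u e * c e} {λ e → v e * c e} (λ e → *-congʳ (u≈v e))

  ·-congʳ : ∀ u {c c′} → (∀ e → c e ≈ c′ e) → u · c ≈ u · c′
  ·-congʳ u {c} {c′} c≈c′ = ∑-cong {λ e → u e * c e} {λ e → u e * c′ e} (λ e → *-congˡ (c≈c′ e))

  ·-termwise : ∀ u c v c′ → (∀ e → u e * c e ≈ v e * c′ e) → u · c ≈ v · c′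
  ·-termwise u c v c′ = ∑-cong {λ e → u e * c e} {λ e → v e * c′ e}

  ·-scaleˡ : ∀ a u c → (λ e → a * u e) · c ≈ a * (u · c)
  ·-scaleˡ a u c = solve 13
    (λ a u₁ u₂ u₃ u₄ u₅ u₆ c₁ c₂ c₃ c₄ c₅ c₆ →
       a :* u₁ :* c₁ :+ a :* u₂ :* c₂ :+ a :* u₃ :* c₃ :+ a :* u₄ :* c₄ :+ a :* u₅ :* c₅ :+ a :* u₆ :* c₆
       := a :* (u₁ :* c₁ :+ u₂ :* c₂ :+ u₃ :* c₃ :+ u₄ :* c₄ :+ u₅ :* c₅ :+ u₆ :* c₆))
    refl a (u e01) (u e02) (u e03) (u e12) (u e13) (u e23) (c e01) (c e02) (c e03) (c e12) (c e13) (c e23)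

  ·-distribˡ : ∀ u v c → (λ e → u e + v e) · c ≈ u · c + v · c
  ·-distribˡ u v c = solve 18
    (λ u₁ u₂ u₃ u₄ u₅ u₆ v₁ v₂ v₃ v₄ v₅ v₆ c₁ c₂ c₃ c₄ c₅ c₆ →
       (u₁ :+ v₁) :* c₁ :+ (u₂ :+ v₂) :* c₂ :+ (u₃ :+ v₃) :* c₃ :+ (u₄ :+ v₄) :* c₄ :+ (u₅ :+ v₅) :* c₅ :+ (u₆ :+ v₆) :* c₆
       := (u₁ :* c₁ :+ u₂ :* c₂ :+ u₃ :* c₃ :+ u₄ :* c₄ :+ u₅ :* c₅ :+ u₆ :* c₆)
          :+ (v₁ :* c₁ :+ v₂ :* c₂ :+ v₃ :* c₃ :+ v₄ :* c₄ :+ v₅ :* c₅ :+ v₆ :* c₆))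
    refl (u e01) (u e02) (u e03) (u e12) (u e13) (u e23) (v e01) (v e02) (v e03) (v e12) (v e13) (v e23)
         (c e01) (c e02) (c e03) (c e12) (c e13) (c e23)

  zero· : ∀ c → (λ _ → 0#) · c ≈ 0#
  zero· c = solve 6 (λ c₁ c₂ c₃ c₄ c₅ c₆ →
    con (+ 0) :* c₁ :+ con (+ 0) :* c₂ :+ con (+ 0) :* c₃ :+ con (+ 0) :* c₄ :+ con (+ 0) :* c₅ :+ con (+ 0) :* c₆
    := con (+ 0)) refl (c e01) (c e02) (c e03) (c e12) (c e13) (c e23)

  KernelEmbeds : AnyMat 𝔽 → AnyMat 𝔽 → Set (c ⊔ ℓ)
  KernelEmbeds (m , A) (n , B) =
    Σ[ d ∈ (Edge → Carrier) ] (∀ e → d e ≉0) × (∀ c → Kernel A c → Kernel B (d ⊙ c))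

  ⊆⇒KernelEmbeds : ∀ {m n} (A : Mat 𝔽 m) (B : Mat 𝔽 n) →
                   (∀ c → Kernel A c → Kernel B c) → KernelEmbeds (m , A) (n , B)
  ⊆⇒KernelEmbeds A B ker⊆ = (λ _ → 1#) , (λ _ → 1≉0) ,
    λ c Ac≈0 i → trans (·-congʳ (B i) (λ e → *-identityˡ (c e))) (ker⊆ c Ac≈0 i)

  KernelEmbeds-refl : ∀ {X} → KernelEmbeds X X
  KernelEmbeds-refl {_ , A} = ⊆⇒KernelEmbeds A A (λ _ Ac≈0 → Ac≈0)

  KernelEmbeds-trans : ∀ {X Y Z} → KernelEmbeds X Y → KernelEmbeds Y Z → KernelEmbeds X Z
  KernelEmbeds-trans {_ , A} {_ , B} {_ , C} (d , d≉0 , A⇒B) (d′ , d′≉0 , B⇒C) =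
    (d′ ⊙ d) , (λ e → *-≉0 (d′≉0 e) (d≉0 e)) ,
    λ c Ac≈0 i → trans (·-congʳ (C i) (λ e → *-assoc (d′ e) (d e) (c e))) (B⇒C (d ⊙ c) (A⇒B c Ac≈0) i)

  scaleAt : Edge → Carrier → Edge → Carrier
  scaleAt f a e with edgeEq? e f
  ... | yes _ = a
  ... | no _ = 1#

  scaleAt-≉0 : ∀ f {a} → a ≉0 → ∀ e → scaleAt f a e ≉0
  scaleAt-≉0 f a≉0 e with edgeEq? e f
  ... | yes _ = a≉0
  ... | no _ = 1≉0

  step⇒KernelEmbeds : ∀ {X Y} → Step 𝔽 X Y → KernelEmbeds X Y
  step⇒KernelEmbeds (≈-step A B A≈B) =
    ⊆⇒KernelEmbeds A B (λ c Ac≈0 i → trans (·-congˡ c (λ e → sym (A≈B i e))) (Ac≈0 i))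
  step⇒KernelEmbeds {Y = _ , B} (rowSwap A i j) = ⊆⇒KernelEmbeds A B (λ c Ac≈0 k → Ac≈0 _)
  step⇒KernelEmbeds {Y = _ , B} (rowScale A i a a≉0) = ⊆⇒KernelEmbeds A B kernel⊆
    where
    kernel⊆ : ∀ c → Kernel A c → Kernel B c
    kernel⊆ c Ac≈0 k with k ≟ i
    ... | yes _ = trans (·-scaleˡ a (A k) c) (trans (*-congˡ (Ac≈0 k)) (zeroʳ a))
    ... | no _ = Ac≈0 k
  step⇒KernelEmbeds {Y = _ , B} (rowAdd A i j a i≢j) = ⊆⇒KernelEmbeds A B kernel⊆
    where
    kernel⊆ : ∀ c → Kernel A c → Kernel B c
    kernel⊆ c Ac≈0 k with k ≟ i
    ... | yes ≡.refl = begin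
      (λ e → A k e + a * A j e) · c   ≈⟨ ·-distribˡ (A k) (λ e → a * A j e) c ⟩
      A k · c + (λ e → a * A j e) · c ≈⟨ +-cong (Ac≈0 k) (·-scaleˡ a (A j) c) ⟩
      0# + a * (A j · c)              ≈⟨ +-identityˡ _ ⟩
      a * (A j · c)                   ≈⟨ *-congˡ (Ac≈0 j) ⟩
      a * 0#                          ≈⟨ zeroʳ a ⟩
      0#                              ∎
    ... | no _ = Ac≈0 k
  step⇒KernelEmbeds {Y = _ , B} (colScale A f a a≉0) = scaleAt f (a ⁻¹) , scaleAt-≉0 f (⁻¹-≉0 a≉0) ,
    λ c Ac≈0 k → trans (·-termwise (B k) (scaleAt f (a ⁻¹) ⊙ c) (A k) c (cancel k c)) (Ac≈0 k)
    where
    cancel : ∀ k c e → B k e * (scaleAt f (a ⁻¹) e * c e) ≈ A k e * c e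
    cancel k c e with edgeEq? e f
    ... | yes _ = x*a*[a⁻¹*y]≈x*y (A k e) (c e) a≉0
    ... | no _ = *-congˡ (*-identityˡ (c e))
  step⇒KernelEmbeds {Y = _ , B} (adjoinZero A) = ⊆⇒KernelEmbeds A B kernel⊆
    where
    kernel⊆ : ∀ c → Kernel A c → Kernel B c
    kernel⊆ c Ac≈0 zero = zero· c
    kernel⊆ c Ac≈0 (suc k) = Ac≈0 k

  step⇒KernelEmbeds⁻¹ : ∀ {X Y} → Step 𝔽 X Y → KernelEmbeds Y X
  step⇒KernelEmbeds⁻¹ (≈-step A B A≈B) =
    ⊆⇒KernelEmbeds B A (λ c Bc≈0 i → trans (·-congˡ c (A≈B i)) (Bc≈0 i))
  step⇒KernelEmbeds⁻¹ {Y = m , B} (rowSwap A i j) = ⊆⇒KernelEmbeds B A kernel⊆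
    where
    kernel⊆ : ∀ c → Kernel B c → Kernel A c
    kernel⊆ c Bc≈0 k = subst (λ u → u · c ≈ 0#) (proj₂ (row-of-B k)) (Bc≈0 (proj₁ (row-of-B k)))
      where
      B-at-j : B j ≡ A i
      B-at-j with j ≟ i
      ... | yes ≡.refl = ≡.refl
      ... | no _ with j ≟ j
      ...   | yes _ = ≡.refl
      ...   | no j≢j = ⊥-elim (j≢j ≡.refl)

      B-at-i : B i ≡ A j
      B-at-i with i ≟ i
      ... | yes _ = ≡.refl
      ... | no i≢i = ⊥-elim (i≢i ≡.refl)

      B-elsewhere : ∀ {k} → k ≢ i → k ≢ j → B k ≡ A k
      B-elsewhere {k} k≢i k≢j with k ≟ i
      ... | yes k≡i = ⊥-elim (k≢i k≡i)
      ... | no _ with k ≟ j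
      ...   | yes k≡j = ⊥-elim (k≢j k≡j)
      ...   | no _ = ≡.refl

      row-of-B : ∀ k → Σ[ k′ ∈ Fin m ] B k′ ≡ A k
      row-of-B k with k ≟ i | k ≟ j
      ... | yes ≡.refl | _ = j , B-at-j
      ... | no _ | yes ≡.refl = i , B-at-i
      ... | no k≢i | no k≢j = k , B-elsewhere k≢i k≢j

  step⇒KernelEmbeds⁻¹ {Y = _ , B} (rowScale A i a a≉0) = ⊆⇒KernelEmbeds B A kernel⊆
    where
    kernel⊆ : ∀ c → Kernel B c → Kernel A c
    kernel⊆ c Bc≈0 k with k ≟ i | Bc≈0 k
    ... | yes _ | aAkc≈0 = x*y≈0⇒x≈0 a≉0 (trans (*-comm _ a) (trans (sym (·-scaleˡ a (A k) c)) aAkc≈0))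
    ... | no _ | Akc≈0 = Akc≈0
  step⇒KernelEmbeds⁻¹ {Y = _ , B} (rowAdd A i j a i≢j) = ⊆⇒KernelEmbeds B A kernel⊆
    where
    kernel⊆ : ∀ c → Kernel B c → Kernel A c
    kernel⊆ c Bc≈0 k with k ≟ i | Bc≈0 k | j ≟ i | Bc≈0 j
    ... | yes ≡.refl | Bkc≈0 | no _ | Ajc≈0 = begin
      A k · c                          ≈⟨ +-identityʳ _ ⟨
      A k · c + 0#                     ≈⟨ +-congˡ (trans (*-congˡ Ajc≈0) (zeroʳ a)) ⟨
      A k · c + a * (A j · c)          ≈⟨ +-congˡ (·-scaleˡ a (A j) c) ⟨
      A k · c + (λ e → a * A j e) · c  ≈⟨ ·-distribˡ (A k) (λ e → a * A j e) c ⟨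
      (λ e → A k e + a * A j e) · c    ≈⟨ Bkc≈0 ⟩
      0#                               ∎
    ... | yes ≡.refl | _ | yes ≡.refl | _ = ⊥-elim (i≢j ≡.refl)
    ... | no _ | Akc≈0 | _ | _ = Akc≈0
  step⇒KernelEmbeds⁻¹ {Y = _ , B} (colScale A f a a≉0) = scaleAt f a , scaleAt-≉0 f a≉0 ,
    λ c Bc≈0 k → trans (·-termwise (A k) (scaleAt f a ⊙ c) (B k) c (reassociate k c)) (Bc≈0 k)
    where
    reassociate : ∀ k c e → A k e * (scaleAt f a e * c e) ≈ B k e * c e
    reassociate k c e with edgeEq? e f
    ... | yes _ = sym (*-assoc (A k e) a (c e))
    ... | no _ = *-congˡ (*-identityˡ (c e))
  step⇒KernelEmbeds⁻¹ {Y = _ , B} (adjoinZero A) = ⊆⇒KernelEmbeds B A (λ c Bc≈0 k → Bc≈0 (suc k))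

  projectivelyEquivalent⇒KernelEmbeds : ∀ {X Y} → ProjectivelyEquivalent 𝔽 X Y → KernelEmbeds X Y
  projectivelyEquivalent⇒KernelEmbeds =
    Star.fold KernelEmbeds (λ {X} {Y} {Z} s → KernelEmbeds-trans {X} {Y} {Z} (embeds s)) (λ {X} → KernelEmbeds-refl {X})
    where
    embeds : ∀ {X Y} → SymClosure (Step 𝔽) X Y → KernelEmbeds X Y
    embeds (fwd s) = step⇒KernelEmbeds s
    embeds (bwd s) = step⇒KernelEmbeds⁻¹ s

  scaleColumns : ∀ {m} (A : Mat 𝔽 m) (s : Edge → Carrier) → (∀ e → s e ≉0) →
                 ProjectivelyEquivalent 𝔽 (m , A) (m , λ k e → A k e * s e)
  scaleColumns A s s≉0 =
    fwd (colScale A e01 (s e01) (s≉0 e01)) ◅ fwd (colScale _ e02 (s e02) (s≉0 e02)) ◅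
    fwd (colScale _ e03 (s e03) (s≉0 e03)) ◅ fwd (colScale _ e12 (s e12) (s≉0 e12)) ◅
    fwd (colScale _ e13 (s e13) (s≉0 e13)) ◅ fwd (colScale _ e23 (s e23) (s≉0 e23)) ◅
    fwd (≈-step _ _ λ { _ e01 → refl ; _ e02 → refl ; _ e03 → refl
                      ; _ e12 → refl ; _ e13 → refl ; _ e23 → refl }) ◅ ε

  scaleRows : (A : Mat 𝔽 4) (r : Fin 4 → Carrier) → (∀ v → r v ≉0) →
              ProjectivelyEquivalent 𝔽 (4 , A) (4 , λ v e → r v * A v e)
  scaleRows A r r≉0 =
    fwd (rowScale A (# 0) (r (# 0)) (r≉0 (# 0))) ◅ fwd (rowScale _ (# 1) (r (# 1)) (r≉0 (# 1))) ◅
    fwd (rowScale _ (# 2) (r (# 2)) (r≉0 (# 2))) ◅ fwd (rowScale _ (# 3) (r (# 3)) (r≉0 (# 3))) ◅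
    fwd (≈-step _ _ λ { zero _ → refl ; (suc zero) _ → refl
                      ; (suc (suc zero)) _ → refl ; (suc (suc (suc zero))) _ → refl }) ◅ ε

  switched-frameMatrix : ∀ (φ ψ : GainFunction 𝔽) (η : Fin 4 → Carrier) → (∀ v → η v ≉0) →
    (∀ e → gain ψ e ≈ ((η (tail e) ⁻¹) * gain φ e) * η (head e)) →
    ∀ v e → (η v * frameMatrix 𝔽 φ v e) * η (tail e) ⁻¹ ≈ frameMatrix 𝔽 ψ v e
  switched-frameMatrix φ ψ η η≉0 switched v e with v ≟ tail e
  ... | yes ≡.refl = trans (*-congʳ (*-identityʳ (η v))) (⁻¹-inverse (η v) (η≉0 v))
  ... | no _ with v ≟ head e
  ...   | yes ≡.refl = begin
          (η v * - gain φ e) * η (tail e) ⁻¹   ≈⟨ solve 3 (λ u g t′ → (u :* :- g) :* t′ := :- ((t′ :* g) :* u))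
                                                           refl (η v) (gain φ e) (η (tail e) ⁻¹) ⟩
          - ((η (tail e) ⁻¹ * gain φ e) * η v)  ≈⟨ -‿cong (switched e) ⟨
          - gain ψ e                             ∎
  ...   | no _ = trans (*-congʳ (zeroʳ (η v))) (zeroˡ (η (tail e) ⁻¹))

  switching⇒projective : ∀ (φ ψ : GainFunction 𝔽) → SwitchingEquivalent 𝔽 φ ψ →
    ProjectivelyEquivalent 𝔽 (4 , frameMatrix 𝔽 φ) (4 , frameMatrix 𝔽 ψ)
  switching⇒projective φ ψ (η , η≉0 , switched) =
    scaleRows (frameMatrix 𝔽 φ) η η≉0 ◅◅
    scaleColumns _ (λ e → η (tail e) ⁻¹) (λ e → ⁻¹-≉0 (η≉0 (tail e))) ◅◅
    fwd (≈-step _ _ (switched-frameMatrix φ ψ η η≉0 switched)) ◅ ε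

  -- Frame entries, triangle imbalances and circuits are written once as polynomials in gain
  -- variables g: evaluated they are the field quantities, as syntax they are the solver's input.
  module GainPolynomials {n} (g : Edge → Polynomial n) where

    Frame : Fin 4 → Edge → Polynomial n
    Frame v e with v ≟ tail e
    ... | yes _ = con (+ 1)
    ... | no _ with v ≟ head e
    ...   | yes _ = :- g e
    ...   | no _ = con (+ 0)

    Δ : Triangle 𝔽 → Polynomial n
    Δ t = g (tri-ab 𝔽 t) :* g (tri-bc 𝔽 t) :- g (tri-ac 𝔽 t)

    _·ₚ_ : (Edge → Polynomial n) → (Edge → Polynomial n) → Polynomial n
    U ·ₚ C = foldEdges _:+_ (λ e → U e :* C e)

    -- Circuit r is a kernel vector of the frame matrix supported on the theta graph K₄ − r.
    -- On the two edges at an endpoint v of r its entries are, up to sign and a frame entry,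
    -- the imbalance Δ of the triangle opposite v.
    Circuit : Edge → Edge → Polynomial n
    Circuit e01 e01 = con (+ 0)
    Circuit e01 e02 = Δ t123
    Circuit e01 e03 = :- Δ t123
    Circuit e01 e12 = :- Δ t023
    Circuit e01 e13 = Δ t023
    Circuit e01 e23 = g e02 :* Δ t123 :- g e12 :* Δ t023
    Circuit e02 e01 = Δ t123
    Circuit e02 e02 = con (+ 0)
    Circuit e02 e03 = :- Δ t123
    Circuit e02 e12 = :- Δ t013
    Circuit e02 e13 = g e01 :* Δ t123 :+ Δ t013
    Circuit e02 e23 = :- (g e12 :* Δ t013)
    Circuit e03 e01 = Δ t123
    Circuit e03 e02 = :- Δ t123
    Circuit e03 e03 = con (+ 0)
    Circuit e03 e12 = g e01 :* Δ t123 :- g e23 :* Δ t012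
    Circuit e03 e13 = g e23 :* Δ t012
    Circuit e03 e23 = :- (g e13 :* Δ t012)
    Circuit e12 e01 = Δ t023
    Circuit e12 e02 = :- Δ t013
    Circuit e12 e03 = Δ t013 :- Δ t023
    Circuit e12 e12 = con (+ 0)
    Circuit e12 e13 = g e01 :* Δ t023
    Circuit e12 e23 = :- (g e02 :* Δ t013)
    Circuit e13 e01 = Δ t023
    Circuit e13 e02 = :- (Δ t023 :+ g e23 :* Δ t012)
    Circuit e13 e03 = g e23 :* Δ t012
    Circuit e13 e12 = g e01 :* Δ t023
    Circuit e13 e13 = con (+ 0)
    Circuit e13 e23 = :- (g e03 :* Δ t012)
    Circuit e23 e01 = g e12 :* Δ t013 :- g e13 :* Δ t012
    Circuit e23 e02 = :- (g e12 :* Δ t013)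
    Circuit e23 e03 = g e13 :* Δ t012
    Circuit e23 e12 = g e02 :* Δ t013
    Circuit e23 e13 = :- (g e03 :* Δ t012)
    Circuit e23 e23 = con (+ 0)

  values : (Edge → Carrier) → Vec Carrier 6
  values f = f e01 ∷ f e02 ∷ f e03 ∷ f e12 ∷ f e13 ∷ f e23 ∷ []

  lookup-values : ∀ f e → lookup (values f) (index e) ≡ f e
  lookup-values f e01 = ≡.refl
  lookup-values f e02 = ≡.refl
  lookup-values f e03 = ≡.refl
  lookup-values f e12 = ≡.refl
  lookup-values f e13 = ≡.refl
  lookup-values f e23 = ≡.refl

  frameMatrix-⟦Frame⟧ : ∀ {n} (χ : GainFunction 𝔽) (g : Edge → Polynomial n) ρ →
                        (∀ e → ⟦ g e ⟧ ρ ≡ gain χ e) →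
                        ∀ v e → frameMatrix 𝔽 χ v e ≡ ⟦ GainPolynomials.Frame g v e ⟧ ρ
  frameMatrix-⟦Frame⟧ χ g ρ ⟦g⟧ v e with v ≟ tail e
  ... | yes _ = ≡.refl
  ... | no _ with v ≟ head e
  ...   | yes _ = ≡.cong -_ (≡.sym (⟦g⟧ e))
  ...   | no _ = ≡.refl

  imbalance : GainFunction 𝔽 → Triangle 𝔽 → Carrier
  imbalance φ t = gain φ (tri-ab 𝔽 t) * gain φ (tri-bc 𝔽 t) - gain φ (tri-ac 𝔽 t)

  imbalance≉0 : ∀ φ t → ¬ Balanced 𝔽 φ t → imbalance φ t ≉0
  imbalance≉0 φ t unbalanced imbalance≈0 = unbalanced (begin
    (gain φ (tri-ab 𝔽 t) * gain φ (tri-bc 𝔽 t)) * gain φ (tri-ac 𝔽 t) ⁻¹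
      ≈⟨ *-congʳ (x∙y⁻¹≈ε⇒x≈y _ _ imbalance≈0) ⟩
    gain φ (tri-ac 𝔽 t) * gain φ (tri-ac 𝔽 t) ⁻¹
      ≈⟨ ⁻¹-inverse _ (nonzero φ (tri-ac 𝔽 t)) ⟩
    1# ∎)

  module SwitchingFromKernel (φ ψ : GainFunction 𝔽) (unbalanced : ∀ t → ¬ Balanced 𝔽 φ t)
                   (d : Edge → Carrier) (d≉0 : ∀ e → d e ≉0)
                   (embeds : ∀ c → Kernel (frameMatrix 𝔽 φ) c → Kernel (frameMatrix 𝔽 ψ) (d ⊙ c)) where

    ρ : Vec Carrier 18
    ρ = values (gain φ) ++ values (gain ψ) ++ values d

    φ̂ ψ̂ d̂ : Edge → Polynomial 18
    φ̂ e = var (index e ↑ˡ 12)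
    ψ̂ e = var (6 ↑ʳ (index e ↑ˡ 6))
    d̂ e = var (6 ↑ʳ (6 ↑ʳ index e))

    ⟦φ̂⟧ : ∀ e → ⟦ φ̂ e ⟧ ρ ≡ gain φ e
    ⟦φ̂⟧ e = ≡.trans (lookup-++ˡ (values (gain φ)) (values (gain ψ) ++ values d) (index e))
                    (lookup-values (gain φ) e)

    ⟦ψ̂⟧ : ∀ e → ⟦ ψ̂ e ⟧ ρ ≡ gain ψ e
    ⟦ψ̂⟧ e = ≡.trans (lookup-++ʳ (values (gain φ)) (values (gain ψ) ++ values d) (index e ↑ˡ 6))
                    (≡.trans (lookup-++ˡ (values (gain ψ)) (values d) (index e)) (lookup-values (gain ψ) e))

    ⟦d̂⟧ : ∀ e → ⟦ d̂ e ⟧ ρ ≡ d e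
    ⟦d̂⟧ e = ≡.trans (lookup-++ʳ (values (gain φ)) (values (gain ψ) ++ values d) (6 ↑ʳ index e))
                    (≡.trans (lookup-++ʳ (values (gain ψ)) (values d) (index e)) (lookup-values d e))

    module Φ = GainPolynomials φ̂
    module Ψ = GainPolynomials ψ̂

    circuit : Edge → Edge → Carrier
    circuit r e = ⟦ Φ.Circuit r e ⟧ ρ

    circuit-normal-form : ∀ r v → ⟦ Φ.Frame v Φ.·ₚ Φ.Circuit r ⟧↓ ρ ≈ ⟦ con (+ 0) ⟧↓ ρ
    circuit-normal-form e01 zero = refl
    circuit-normal-form e01 (suc zero) = refl
    circuit-normal-form e01 (suc (suc zero)) = refl
    circuit-normal-form e01 (suc (suc (suc zero))) = refl
    circuit-normal-form e02 zero = refl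
    circuit-normal-form e02 (suc zero) = refl
    circuit-normal-form e02 (suc (suc zero)) = refl
    circuit-normal-form e02 (suc (suc (suc zero))) = refl
    circuit-normal-form e03 zero = refl
    circuit-normal-form e03 (suc zero) = refl
    circuit-normal-form e03 (suc (suc zero)) = refl
    circuit-normal-form e03 (suc (suc (suc zero))) = refl
    circuit-normal-form e12 zero = refl
    circuit-normal-form e12 (suc zero) = refl
    circuit-normal-form e12 (suc (suc zero)) = refl
    circuit-normal-form e12 (suc (suc (suc zero))) = refl
    circuit-normal-form e13 zero = refl
    circuit-normal-form e13 (suc zero) = refl
    circuit-normal-form e13 (suc (suc zero)) = refl
    circuit-normal-form e13 (suc (suc (suc zero))) = refl
    circuit-normal-form e23 zero = refl
    circuit-normal-form e23 (suc zero) = refl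
    circuit-normal-form e23 (suc (suc zero)) = refl
    circuit-normal-form e23 (suc (suc (suc zero))) = refl

    circuit-kernel : ∀ r → Kernel (frameMatrix 𝔽 φ) (circuit r)
    circuit-kernel r v = begin
      frameMatrix 𝔽 φ v · circuit r  ≈⟨ ·-congˡ (circuit r) (λ e → reflexive (frameMatrix-⟦Frame⟧ φ φ̂ ρ ⟦φ̂⟧ v e)) ⟩
      ⟦ Φ.Frame v Φ.·ₚ Φ.Circuit r ⟧ ρ  ≈⟨ prove ρ (Φ.Frame v Φ.·ₚ Φ.Circuit r) (con (+ 0)) (circuit-normal-form r v) ⟩
      0#                             ∎

    Row : Fin 4 → Edge → Polynomial 18
    Row v r = Ψ.Frame v Ψ.·ₚ (λ e → d̂ e :* Φ.Circuit r e)

    ⟦Row⟧≈0 : ∀ v r → ⟦ Row v r ⟧ ρ ≈ 0#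
    ⟦Row⟧≈0 v r = begin
      ⟦ Row v r ⟧ ρ                        ≈⟨ ·-termwise _ _ (frameMatrix 𝔽 ψ v) (d ⊙ circuit r) bridge ⟩
      frameMatrix 𝔽 ψ v · (d ⊙ circuit r)  ≈⟨ embeds (circuit r) (circuit-kernel r) v ⟩
      0#                                   ∎
      where
      bridge : ∀ e → ⟦ Ψ.Frame v e ⟧ ρ * (⟦ d̂ e ⟧ ρ * circuit r e) ≈ frameMatrix 𝔽 ψ v e * (d e * circuit r e)
      bridge e = reflexive (≡.cong₂ (λ a b → a * (b * circuit r e))
                                    (≡.sym (frameMatrix-⟦Frame⟧ ψ ψ̂ ρ ⟦ψ̂⟧ v e)) (⟦d̂⟧ e))

    ⟦Δ⟧ : ∀ t → ⟦ Φ.Δ t ⟧ ρ ≡ imbalance φ t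
    ⟦Δ⟧ t = ≡.cong₂ _-_ (≡.cong₂ _*_ (⟦φ̂⟧ (tri-ab 𝔽 t)) (⟦φ̂⟧ (tri-bc 𝔽 t))) (⟦φ̂⟧ (tri-ac 𝔽 t))

    -- At an endpoint v of r only two terms of row v survive, and the solver rewrites the row
    -- as Δ t * (X - Y), where t is the triangle opposite v.
    endpoint-relation : ∀ v r t X Y → ⟦ Row v r ⟧↓ ρ ≈ ⟦ Φ.Δ t :* (X :- Y) ⟧↓ ρ → ⟦ X ⟧ ρ ≈ ⟦ Y ⟧ ρ
    endpoint-relation v r t X Y normal-forms = τ*[x-y]≈0⇒x≈y Δ≉0 (begin
      ⟦ Φ.Δ t ⟧ ρ * (⟦ X ⟧ ρ - ⟦ Y ⟧ ρ)  ≈⟨ prove ρ (Row v r) (Φ.Δ t :* (X :- Y)) normal-forms ⟨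
      ⟦ Row v r ⟧ ρ                      ≈⟨ ⟦Row⟧≈0 v r ⟩
      0#                                 ∎)
      where
      Δ≉0 : ⟦ Φ.Δ t ⟧ ρ ≉0
      Δ≉0 = subst _≉0 (≡.sym (⟦Δ⟧ t)) (imbalance≉0 φ t (unbalanced t))

    -- η v is d e · A_F(ψ)(v, e) / A_F(φ)(v, e) for one edge e at v.
    η : Fin 4 → Carrier
    η zero = d e01
    η (suc zero) = d e12
    η (suc (suc zero)) = d e23
    η (suc (suc (suc zero))) = (d e03 * gain ψ e03) * gain φ e03 ⁻¹

    tail-rescaling : ∀ e → d e ≈ η (tail e)
    tail-rescaling e01 = refl
    tail-rescaling e02 = sym (endpoint-relation (# 0) e03 t123 (d̂ e01) (d̂ e02) refl)
    tail-rescaling e03 = sym (endpoint-relation (# 0) e02 t123 (d̂ e01) (d̂ e03) refl)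
    tail-rescaling e12 = refl
    tail-rescaling e13 = endpoint-relation (# 1) e01 t023 (d̂ e13) (d̂ e12) refl
    tail-rescaling e23 = refl

    head-rescaling : ∀ e → d e * gain ψ e ≈ η (head e) * gain φ e
    head-rescaling e01 = sym (endpoint-relation (# 1) e13 t023 (d̂ e12 :* φ̂ e01) (d̂ e01 :* ψ̂ e01) refl)
    head-rescaling e02 = endpoint-relation (# 2) e12 t013 (d̂ e02 :* ψ̂ e02) (d̂ e23 :* φ̂ e02) refl
    head-rescaling e03 = x*a≈y*b⇒x≈y*a⁻¹*b (nonzero φ e03) refl
    head-rescaling e12 = endpoint-relation (# 2) e02 t013 (d̂ e12 :* ψ̂ e12) (d̂ e23 :* φ̂ e12) refl
    head-rescaling e13 = x*a≈y*b⇒x≈y*a⁻¹*b (nonzero φ e03)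
      (endpoint-relation (# 3) e23 t012 (d̂ e13 :* ψ̂ e13 :* φ̂ e03) (d̂ e03 :* ψ̂ e03 :* φ̂ e13) refl)
    head-rescaling e23 = x*a≈y*b⇒x≈y*a⁻¹*b (nonzero φ e03)
      (endpoint-relation (# 3) e13 t012 (d̂ e23 :* ψ̂ e23 :* φ̂ e03) (d̂ e03 :* ψ̂ e03 :* φ̂ e23) refl)

    η≉0 : ∀ v → η v ≉0
    η≉0 zero = d≉0 e01
    η≉0 (suc zero) = d≉0 e12
    η≉0 (suc (suc zero)) = d≉0 e23
    η≉0 (suc (suc (suc zero))) = *-≉0 (*-≉0 (d≉0 e03) (nonzero ψ e03)) (⁻¹-≉0 (nonzero φ e03))

    switchingEquivalent : SwitchingEquivalent 𝔽 φ ψ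
    switchingEquivalent =
      η , η≉0 , λ e → rescaling⇒switching (η≉0 (tail e)) (tail-rescaling e) (head-rescaling e)

  projective⇒switching : ∀ (φ ψ : GainFunction 𝔽) → (∀ t → ¬ Balanced 𝔽 φ t) →
    ProjectivelyEquivalent 𝔽 (4 , frameMatrix 𝔽 φ) (4 , frameMatrix 𝔽 ψ) → SwitchingEquivalent 𝔽 φ ψ
  projective⇒switching φ ψ unbalanced A≃B =
    let (d , d≉0 , embeds) = projectivelyEquivalent⇒KernelEmbeds A≃B
    in SwitchingFromKernel.switchingEquivalent φ ψ unbalanced d d≉0 embeds

mainTheorem13 : {c ℓ : Level} (𝔽 : Field c ℓ) (φ ψ : GainFunction 𝔽) →
    (∀ t → ¬ Balanced 𝔽 φ t) →
    SwitchingEquivalent 𝔽 φ ψ ⇔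
      ProjectivelyEquivalent 𝔽 (4 , frameMatrix 𝔽 φ) (4 , frameMatrix 𝔽 ψ)
mainTheorem13 𝔽 φ ψ unbalanced =
  mk⇔ (switching⇒projective 𝔽 φ ψ) (projective⇒switching 𝔽 φ ψ unbalanced)
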